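{- For every graph $G$, if $\chi'_{\mathrm{inj}}(G)=k$, then $\chi_o(G)\le 4^k$.
   Context: Graphs are finite and simple. An injective edge-coloring of $G$ is a function $\psi:E(G)\to\mathbb N$ such that whenever $\psi(e)=\psi(e')$ for distinct edges $e,e'$, no third edge of $G$ joins an endpoint of $e$ to an endpoint of $e'$; $\chi'_{\mathrm{inj}}(G)$ is the minimum number of colors in such a coloring. An oriented graph is a directed graph with no loops, multiple arcs or pairs of opposite arcs. For an oriented graph $\vec G$, an oriented coloring is a proper vertex coloring $\phi$ such that for any two arcs $uv$ and $v'u'$, $(\phi(u),\phi(v))\ne(\phi(u'),\phi(v'))$; $\chi_o(\vec G)$ is the minimum number of colors of such a coloring, and for an undirected $G$, $\chi_o(G)$ is the maximum of $\chi_o(\vec G)$ over all orientations $\vec G$ of $G$. -}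

module Defs where

open import Data.Nat using (ℕ; _≤_; _^_)
open import Data.Fin using (Fin)
open import Data.Bool using (Bool; T)
open import Data.Product using (_×_; Σ)
open import Data.Sum using (_⊎_)
open import Data.Empty using (⊥)
open import Relation.Nullary using (¬_)
open import Relation.Binary.PropositionalEquality using (_≡_)

record Graph : Set where
  field
    n        : ℕ
    adj      : Fin n → Fin n → Bool
    adj-sym  : ∀ u v → T (adj u v) → T (adj v u)
    adj-irr  : ∀ v → ¬ T (adj v v)

open Graph public

Adj : (G : Graph) → Fin (n G) → Fin (n G) → Set
Adj G u v = T (adj G u v)

SameEdge : {V : Set} → V → V → V → V → Set
SameEdge a b c d = (a ≡ c × b ≡ d) ⊎ (a ≡ d × b ≡ c)

-- An edge colouring with (at most) k colours: a colour for each ordered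
-- adjacent pair, symmetric, i.e. a colour for each edge.
record EdgeColouring (G : Graph) (k : ℕ) : Set where
  field
    ψ     : Fin (n G) → Fin (n G) → Fin k
    ψ-sym : ∀ u v → Adj G u v → ψ u v ≡ ψ v u

-- Injective: if distinct edges ab, cd receive the same colour, there is no
-- third edge xy (distinct from ab and cd) with x ∈ {a,b}, y ∈ {c,d}.
IsInjective : (G : Graph) {k : ℕ} → EdgeColouring G k → Set
IsInjective G c = ∀ a b c' d x y →
  Adj G a b → Adj G c' d → ¬ SameEdge a b c' d →
  EdgeColouring.ψ c a b ≡ EdgeColouring.ψ c c' d →
  (x ≡ a ⊎ x ≡ b) → (y ≡ c' ⊎ y ≡ d) → Adj G x y →
  ¬ SameEdge x y a b → ¬ SameEdge x y c' d → ⊥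

HasInjEdgeColouring : Graph → ℕ → Set
HasInjEdgeColouring G k = Σ (EdgeColouring G k) (IsInjective G)

ChiInj≡ : Graph → ℕ → Set
ChiInj≡ G k = HasInjEdgeColouring G k × (∀ m → HasInjEdgeColouring G m → k ≤ m)

record Orientation (G : Graph) : Set where
  field
    arc     : Fin (n G) → Fin (n G) → Bool
    arc-adj : ∀ u v → T (arc u v) → Adj G u v
    arc-one : ∀ u v → Adj G u v →
              (T (arc u v) × ¬ T (arc v u)) ⊎ (T (arc v u) × ¬ T (arc u v))

IsOrientedColouring : {G : Graph} (O : Orientation G) {m : ℕ} →
                      (Fin (n G) → Fin m) → Set
IsOrientedColouring {G} O φ =
  (∀ u v → T (Orientation.arc O u v) → ¬ φ u ≡ φ v) ×
  (∀ u v u' v' → T (Orientation.arc O u v) → T (Orientation.arc O v' u') →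
     φ u ≡ φ u' → φ v ≡ φ v' → ⊥)

ChiO≤ : Graph → ℕ → Set
ChiO≤ G m = (O : Orientation G) → Σ (Fin (n G) → Fin m) (IsOrientedColouring O)

{-# OPTIONS --safe #-}
-- Colour each
-- vertex v by the vector recording, for every colour i, whether v has an out-arc
-- coloured i and whether it has an in-arc coloured i: 4 ^ k colours. Suppose arcs
-- u → v and v' → u' have φ u = φ u' and φ v = φ v', and let i = ψ u v. Then u' has
-- an out-arc u' → w and v' an in-arc z → v', both coloured i; the arc v' → u' joins
-- these two distinct edges of equal colour, contradicting injectivity.
module Submission where

open import Defs
open import Data.Nat using (ℕ; _^_)
open import Data.Fin using (Fin; combine; funToFin; finToFun)
open import Data.Fin.Patterns using (0F; 1F)
open import Data.Fin.Properties using (any?; combine-injective; finToFun-funToFin)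
  renaming (_≟_ to _≟ᶠ_)
open import Data.Bool using (T; T?)
open import Data.Product using (_×_; _,_; proj₁; proj₂; ∃)
open import Data.Sum using (inj₁; inj₂)
open import Data.Empty using (⊥; ⊥-elim)
open import Function using (_∘_)
open import Relation.Nullary using (¬_; Dec; yes; no)
open import Relation.Nullary.Decidable using (_×-dec_)
open import Relation.Binary.PropositionalEquality using (_≡_; _≢_; refl; sym; trans; cong; module ≡-Reasoning)

funToFin-injective : ∀ {m n} (f g : Fin m → Fin n) → funToFin f ≡ funToFin g → ∀ i → f i ≡ g i
funToFin-injective f g f≡g i = begin
  f i                      ≡⟨ finToFun-funToFin f i ⟨
  finToFun (funToFin f) i  ≡⟨ cong (λ x → finToFun x i) f≡g ⟩
  finToFun (funToFin g) i  ≡⟨ finToFun-funToFin g i ⟩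
  g i                      ∎
  where open ≡-Reasoning

bit : ∀ {P : Set} → Dec P → Fin 2
bit (yes _) = 1F
bit (no _)  = 0F

bit-transfer : ∀ {P Q : Set} (p? : Dec P) (q? : Dec Q) → bit p? ≡ bit q? → P → Q
bit-transfer (yes _)  (yes q) _  _ = q
bit-transfer (no ¬p)  _       _  p = ⊥-elim (¬p p)

module _ {G : Graph} (O : Orientation G) where
  open Orientation O

  arc-asym : ∀ {u v} → T (arc u v) → ¬ T (arc v u)
  arc-asym {u} {v} uv with arc-one u v (arc-adj u v uv)
  ... | inj₁ (_ , ¬vu) = ¬vu
  ... | inj₂ (_ , ¬uv) = ⊥-elim (¬uv uv)

  arc-irrefl : ∀ {u v} → T (arc u v) → u ≢ v
  arc-irrefl {u} uv refl = adj-irr G u (arc-adj u u uv)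

module OrientedInjective {G : Graph} {k : ℕ} (C : EdgeColouring G k) (injective : IsInjective G C)
                         (O : Orientation G) where
  open EdgeColouring C
  open Orientation O

  directedPath-end-colours-≢ : ∀ {z v u w} → T (arc z v) → T (arc v u) → T (arc u w) → ψ z v ≢ ψ u w
  directedPath-end-colours-≢ {z} {v} {u} {w} zv vu uw ψzv≡ψuw =
    injective u w z v u v (arc-adj u w uw) (arc-adj z v zv) uw≠zv (sym ψzv≡ψuw)
      (inj₁ refl) (inj₂ refl) (adj-sym G v u (arc-adj v u vu)) uv≠uw uv≠zv
    where
    uw≠zv : ¬ SameEdge u w z v
    uw≠zv (inj₁ (refl , refl)) = arc-asym O zv vu
    uw≠zv (inj₂ (v≡u , _))     = arc-irrefl O vu (sym v≡u)
    uv≠uw : ¬ SameEdge u v u w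
    uv≠uw (inj₁ (_ , refl))    = arc-asym O vu uw
    uv≠uw (inj₂ (_ , v≡u))     = arc-irrefl O vu v≡u
    uv≠zv : ¬ SameEdge u v z v
    uv≠zv (inj₁ (refl , _))    = arc-asym O vu zv
    uv≠zv (inj₂ (u≡v , _))     = arc-irrefl O vu (sym u≡v)

  HasOutArc HasInArc : Fin (n G) → Fin k → Set
  HasOutArc v i = ∃ λ w → T (arc v w) × ψ v w ≡ i
  HasInArc  v i = ∃ λ w → T (arc w v) × ψ w v ≡ i

  hasOutArc? : ∀ v i → Dec (HasOutArc v i)
  hasOutArc? v i = any? (λ w → T? (arc v w) ×-dec (ψ v w ≟ᶠ i))

  hasInArc? : ∀ v i → Dec (HasInArc v i)
  hasInArc? v i = any? (λ w → T? (arc w v) ×-dec (ψ w v ≟ᶠ i))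

  signature : Fin (n G) → Fin k → Fin 4
  signature v i = combine (bit (hasOutArc? v i)) (bit (hasInArc? v i))

  φ : Fin (n G) → Fin (4 ^ k)
  φ = funToFin ∘ signature

  module _ {v v' : Fin (n G)} (φv≡φv' : φ v ≡ φ v') (i : Fin k) where
    private
      bits≡ : bit (hasOutArc? v i) ≡ bit (hasOutArc? v' i) × bit (hasInArc? v i) ≡ bit (hasInArc? v' i)
      bits≡ = combine-injective _ _ _ _ (funToFin-injective (signature v) (signature v') φv≡φv' i)

    HasOutArc-transfer : HasOutArc v i → HasOutArc v' i
    HasOutArc-transfer = bit-transfer (hasOutArc? v i) (hasOutArc? v' i) (proj₁ bits≡)

    HasInArc-transfer : HasInArc v i → HasInArc v' i
    HasInArc-transfer = bit-transfer (hasInArc? v i) (hasInArc? v' i) (proj₂ bits≡)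

  φ-no-reversed-arc-pair : ∀ u v u' v' → T (arc u v) → T (arc v' u') → φ u ≡ φ u' → φ v ≡ φ v' → ⊥
  φ-no-reversed-arc-pair u v u' v' uv v'u' φu≡φu' φv≡φv'
    with HasOutArc-transfer φu≡φu' (ψ u v) (v , uv , refl)
       | HasInArc-transfer φv≡φv' (ψ u v) (u , uv , refl)
  ... | w , u'w , ψu'w≡ψuv | z , zv' , ψzv'≡ψuv =
    directedPath-end-colours-≢ zv' v'u' u'w (trans ψzv'≡ψuv (sym ψu'w≡ψuv))

  φ-isOrientedColouring : IsOrientedColouring O φ
  φ-isOrientedColouring =
    (λ u v uv φu≡φv → φ-no-reversed-arc-pair u v v u uv uv φu≡φv (sym φu≡φv)) ,
    φ-no-reversed-arc-pair

lemma4p1 : (G : Graph) (k : ℕ) → ChiInj≡ G k → ChiO≤ G (4 ^ k)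
lemma4p1 G k ((C , injective) , _) O = φ , φ-isOrientedColouring
  where open OrientedInjective C injective O
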